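{- Let $U\subseteq\mathbb Z$ be infinite, $C\in\mathbb R$ and $d\in\mathbb N$. Suppose $f\in LIP(U)$ satisfies $|f(x)|\le C|x|^d$ for infinitely many $x\in U$. Then there is a polynomial $p\in\mathbb Z[x]$ with $f(x)=p(x)$ for all $x\in U$.
   Context: For an infinite $U\subseteq\mathbb Z$, a function $f\colon U\to\mathbb Z$ is LIP on $U$ if for every finite $X\subseteq U$ there is $p\in\mathbb Z[x]$ with $p(x)=f(x)$ for all $x\in X$; $LIP(U)$ is the ring of all such functions.
   Formalization: The constant C in the growth bound ranges over ℚ instead of ℝ. -}

module Defs where

open import Data.Nat using (ℕ)
open import Data.Integer as ℤ using (ℤ; +_)
open import Data.Rational as ℚ using (ℚ)
open import Data.List using (List; []; _∷_)
open import Data.List.Membership.Propositional using (_∉_)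
open import Data.List.Relation.Unary.All using (All)
open import Data.Product using (Σ; ∃; _×_; proj₁)

-- Polynomials in ℤ[x] as coefficient lists, constant term first.
Poly : Set
Poly = List ℤ

eval : Poly → ℤ → ℤ
eval []       x = ℤ.+ 0
eval (a ∷ as) x = a ℤ.+ x ℤ.* eval as x

Subset : Set₁
Subset = ℤ → Set

FunOn : Subset → Set
FunOn U = (x : ℤ) → U x → ℤ

-- Infinitely many integers satisfy P: P avoids every finite list.
InfinitelyMany : (ℤ → Set) → Set
InfinitelyMany P = (xs : List ℤ) → ∃ λ x → P x × x ∉ xs

Infinite : Subset → Set
Infinite U = InfinitelyMany U

IsLIP : (U : Subset) → FunOn U → Set
IsLIP U f = (X : List (Σ ℤ U)) →
  ∃ λ (p : Poly) → All (λ xu → eval p (proj₁ xu) ≡ f (proj₁ xu) (Data.Product.proj₂ xu)) X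
  where open import Relation.Binary.PropositionalEquality using (_≡_)

toℚ : ℤ → ℚ
toℚ n = n ℚ./ 1

{-# OPTIONS --safe #-}
-- Let P, of degree at most d, interpolate f on d + 1 points A of U; it has integer
-- coefficients, being the Newton form of a LIP witness on A.  For z ∈ U, a LIP witness on
-- A ∪ {z} shows that f(z) ≡ P(z) modulo ∏_{a ∈ A} (z - a), which has size about |z|^(d+1),
-- so f(z) = P(z) whenever |z| is large and |f(z)| ≤ C|z|^d.  Hence f = P at infinitely
-- many points z, and for every y ∈ U a LIP witness on {y, z} shows that y - z divides
-- f(y) - P(y); taking |z| large forces f(y) = P(y).
module Submission where

open import Defs
open import Data.Nat using (ℕ; zero; suc; z≤n; s≤s; _≤_; _<_)
import Data.Nat as ℕ
import Data.Nat.Properties as ℕ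
open import Data.Nat.Divisibility using (∣⇒≤)
open import Data.Nat.Tactic.RingSolver using () renaming (solve-∀ to ℕ-solve-∀)
open import Data.Nat.Coprimality as Coprime using (1-coprimeTo)
open import Data.Integer as ℤ using (ℤ; +_; ∣_∣; _+_; _*_; _-_; -_)
import Data.Integer.Properties as ℤ
open import Data.Integer.Divisibility.Signed using (_∣_; divides; *-monoʳ-∣; ∣⇒∣ᵤ)
open import Data.Integer.Tactic.RingSolver using (solve-∀)
open import Data.Rational as ℚ using (ℚ; mkℚ)
import Data.Rational.Properties as ℚ
import Data.Rational.Unnormalised as ℚᵘ
import Data.Rational.Unnormalised.Properties as ℚᵘ
open import Data.Product using (Σ; ∃; _×_; _,_; proj₁; proj₂)
open import Data.Sum using (inj₁; inj₂)
open import Data.List using (List; []; _∷_; _++_; map; length)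
open import Data.List.Properties using (length-map)
open import Data.List.Membership.Propositional using (_∈_; _∉_)
open import Data.List.Membership.Propositional.Properties using (∈-++⁺ˡ; ∈-++⁺ʳ)
open import Data.List.Relation.Unary.Any using (here; there)
open import Data.List.Relation.Unary.All as All using (All; []; _∷_)
open import Data.List.Relation.Unary.All.Properties using (¬Any⇒All¬; map⁺; map⁻)
open import Data.List.Relation.Unary.AllPairs using (AllPairs; []; _∷_)
open import Function using (_∘_)
open import Relation.Nullary using (contradiction; yes; no)
open import Relation.Binary.PropositionalEquality
  using (_≡_; _≢_; refl; sym; trans; cong; cong₂; subst; subst₂; module ≡-Reasoning)

divLinear : Poly → ℤ → Poly
divLinear []              a = []
divLinear (_ ∷ [])        a = []
divLinear (_ ∷ r@(_ ∷ _)) a = eval r a ∷ divLinear r a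

eval-divLinear : ∀ q a y → eval q y ≡ eval q a + (y - a) * eval (divLinear q a) y
eval-divLinear []              a y = ring y a
  where
  ring : ∀ y a → + 0 ≡ + 0 + (y - a) * + 0
  ring = solve-∀
eval-divLinear (c ∷ [])        a y = ring c y a
  where
  ring : ∀ c y a → c + y * + 0 ≡ (c + a * + 0) + (y - a) * + 0
  ring = solve-∀
eval-divLinear (c ∷ r@(_ ∷ _)) a y = begin
  c + y * eval r y
    ≡⟨ cong (λ v → c + y * v) (eval-divLinear r a y) ⟩
  c + y * (eval r a + (y - a) * eval (divLinear r a) y)
    ≡⟨ ring c y a (eval r a) (eval (divLinear r a) y) ⟩
  (c + a * eval r a) + (y - a) * (eval r a + y * eval (divLinear r a) y)
    ∎
  where
  open ≡-Reasoning
  ring : ∀ c y a e s → c + y * (e + (y - a) * s) ≡ (c + a * e) + (y - a) * (e + y * s)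
  ring = solve-∀

length-divLinear : ∀ q a {n} → length q ≤ suc n → length (divLinear q a) ≤ n
length-divLinear []              a _                 = z≤n
length-divLinear (_ ∷ [])        a _                 = z≤n
length-divLinear (_ ∷ r@(_ ∷ _)) a (s≤s r≤n@(s≤s _)) = s≤s (length-divLinear r a r≤n)

divLinear-cong : ∀ q p {a b} → eval q a ≡ eval p a → b ≢ a → eval q b ≡ eval p b →
                 eval (divLinear q a) b ≡ eval (divLinear p a) b
divLinear-cong q p {a} {b} qa≡pa b≢a qb≡pb =
  ℤ.*-cancelˡ-≡ (b - a) _ _ {{ℤ.≢-nonZero (b≢a ∘ ℤ.i-j≡0⇒i≡j b a)}} (begin
    (b - a) * eval (divLinear q a) b ≡⟨ factor q ⟩
    eval q b - eval q a              ≡⟨ cong₂ _-_ qb≡pb qa≡pa ⟩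
    eval p b - eval p a              ≡⟨ factor p ⟨
    (b - a) * eval (divLinear p a) b ∎)
  where
  open ≡-Reasoning
  factor : ∀ r → (b - a) * eval (divLinear r a) b ≡ eval r b - eval r a
  factor r = trans (ring (eval r a) _) (cong (_- eval r a) (sym (eval-divLinear r a b)))
    where
    ring : ∀ e s → s ≡ (e + s) - e
    ring = solve-∀

newtonStep : ℤ → ℤ → Poly → Poly
newtonStep c a []       = c ∷ []
newtonStep c a (b ∷ bs) = (c - a * b) ∷ newtonStep b a bs

eval-newtonStep : ∀ c a p y → eval (newtonStep c a p) y ≡ c + (y - a) * eval p y
eval-newtonStep c a []       y = ring c a y
  where
  ring : ∀ c a y → c + y * + 0 ≡ c + (y - a) * + 0
  ring = solve-∀
eval-newtonStep c a (b ∷ bs) y = begin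
  (c - a * b) + y * eval (newtonStep b a bs) y
    ≡⟨ cong (λ v → (c - a * b) + y * v) (eval-newtonStep b a bs y) ⟩
  (c - a * b) + y * (b + (y - a) * eval bs y)
    ≡⟨ ring c a b y (eval bs y) ⟩
  c + (y - a) * (b + y * eval bs y)
    ∎
  where
  open ≡-Reasoning
  ring : ∀ c a b y e → (c - a * b) + y * (b + (y - a) * e) ≡ c + (y - a) * (b + y * e)
  ring = solve-∀

length-newtonStep : ∀ c a p → length (newtonStep c a p) ≡ suc (length p)
length-newtonStep c a []       = refl
length-newtonStep c a (b ∷ bs) = cong suc (length-newtonStep b a bs)

interpolate : List ℤ → Poly → Poly
interpolate []       q = []
interpolate (a ∷ as) q = newtonStep (eval q a) a (interpolate as (divLinear q a))

length-interpolate : ∀ as q → length (interpolate as q) ≡ length as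
length-interpolate []       q = refl
length-interpolate (a ∷ as) q =
  trans (length-newtonStep (eval q a) a (interpolate as (divLinear q a)))
        (cong suc (length-interpolate as (divLinear q a)))

interpolate-agrees : ∀ as q → All (λ b → eval (interpolate as q) b ≡ eval q b) as
interpolate-agrees []       q = []
interpolate-agrees (a ∷ as) q = at-a ∷ All.map at-rest (interpolate-agrees as (divLinear q a))
  where
  open ≡-Reasoning
  I : Poly
  I = interpolate as (divLinear q a)
  at-a : eval (interpolate (a ∷ as) q) a ≡ eval q a
  at-a = begin
    eval (interpolate (a ∷ as) q) a ≡⟨ eval-newtonStep (eval q a) a I a ⟩
    eval q a + (a - a) * eval I a   ≡⟨ cong (λ v → eval q a + v * eval I a) (ℤ.+-inverseʳ a) ⟩
    eval q a + + 0 * eval I a       ≡⟨ ring (eval q a) (eval I a) ⟩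
    eval q a                        ∎
    where
    ring : ∀ e s → e + + 0 * s ≡ e
    ring = solve-∀
  at-rest : ∀ {b} → eval I b ≡ eval (divLinear q a) b → eval (interpolate (a ∷ as) q) b ≡ eval q b
  at-rest {b} agrees = begin
    eval (interpolate (a ∷ as) q) b             ≡⟨ eval-newtonStep (eval q a) a I b ⟩
    eval q a + (b - a) * eval I b               ≡⟨ cong (λ v → eval q a + (b - a) * v) agrees ⟩
    eval q a + (b - a) * eval (divLinear q a) b ≡⟨ eval-divLinear q a b ⟨
    eval q b                                    ∎

nodeProduct : List ℤ → ℤ → ℤ
nodeProduct []       y = + 1
nodeProduct (a ∷ as) y = (y - a) * nodeProduct as y

agree⇒nodeProduct∣ : ∀ q p {as} → AllPairs _≢_ as → All (λ a → eval q a ≡ eval p a) as →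
                     ∀ y → nodeProduct as y ∣ eval q y - eval p y
agree⇒nodeProduct∣ q p []       [] y =
  divides (eval q y - eval p y) (sym (ℤ.*-identityʳ (eval q y - eval p y)))
agree⇒nodeProduct∣ q p {a ∷ as} (a≢as ∷ distinct) (qa≡pa ∷ agree) y =
  subst (nodeProduct (a ∷ as) y ∣_) (sym difference) (*-monoʳ-∣ (y - a) quotients∣)
  where
  quotients-agree : ∀ {b} → a ≢ b × eval q b ≡ eval p b →
                    eval (divLinear q a) b ≡ eval (divLinear p a) b
  quotients-agree (a≢b , qb≡pb) = divLinear-cong q p qa≡pa (a≢b ∘ sym) qb≡pb
  difference : eval q y - eval p y ≡ (y - a) * (eval (divLinear q a) y - eval (divLinear p a) y)
  difference = begin
    eval q y - eval p y
      ≡⟨ cong₂ _-_ (eval-divLinear q a y) (eval-divLinear p a y) ⟩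
    (eval q a + (y - a) * Qy) - (eval p a + (y - a) * Py)
      ≡⟨ cong (λ v → (eval q a + (y - a) * Qy) - (v + (y - a) * Py)) (sym qa≡pa) ⟩
    (eval q a + (y - a) * Qy) - (eval q a + (y - a) * Py)
      ≡⟨ ring (eval q a) (y - a) Qy Py ⟩
    (y - a) * (Qy - Py)
      ∎
    where
    open ≡-Reasoning
    Qy Py : ℤ
    Qy = eval (divLinear q a) y
    Py = eval (divLinear p a) y
    ring : ∀ c d s t → (c + d * s) - (c + d * t) ≡ d * (s - t)
    ring = solve-∀
  quotients∣ : nodeProduct as y ∣ eval (divLinear q a) y - eval (divLinear p a) y
  quotients∣ = agree⇒nodeProduct∣ (divLinear q a) (divLinear p a) distinct
                 (All.zipWith quotients-agree (a≢as , agree)) y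

∣x∣≤2∣x-a∣ : ∀ x a → 2 ℕ.* ∣ a ∣ ≤ ∣ x ∣ → ∣ x ∣ ≤ 2 ℕ.* ∣ x - a ∣
∣x∣≤2∣x-a∣ x a 2∣a∣≤∣x∣ = ℕ.+-cancelʳ-≤ ∣ x ∣ ∣ x ∣ (2 ℕ.* ∣ x - a ∣) (begin
  ∣ x ∣ ℕ.+ ∣ x ∣                                 ≤⟨ ℕ.+-mono-≤ triangle triangle ⟩
  (∣ x - a ∣ ℕ.+ ∣ a ∣) ℕ.+ (∣ x - a ∣ ℕ.+ ∣ a ∣) ≡⟨ ring ∣ x - a ∣ ∣ a ∣ ⟩
  2 ℕ.* ∣ x - a ∣ ℕ.+ 2 ℕ.* ∣ a ∣                 ≤⟨ ℕ.+-monoʳ-≤ (2 ℕ.* ∣ x - a ∣) 2∣a∣≤∣x∣ ⟩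
  2 ℕ.* ∣ x - a ∣ ℕ.+ ∣ x ∣                       ∎)
  where
  open ℕ.≤-Reasoning
  triangle : ∣ x ∣ ≤ ∣ x - a ∣ ℕ.+ ∣ a ∣
  triangle = subst (λ v → ∣ v ∣ ≤ ∣ x - a ∣ ℕ.+ ∣ a ∣) (ring′ x a) (ℤ.∣i+j∣≤∣i∣+∣j∣ (x - a) a)
    where
    ring′ : ∀ x a → (x - a) + a ≡ x
    ring′ = solve-∀
  ring : ∀ w b → (w ℕ.+ b) ℕ.+ (w ℕ.+ b) ≡ 2 ℕ.* w ℕ.+ 2 ℕ.* b
  ring = ℕ-solve-∀

∣d∣∣e∣≤∣c∣+∣c+d*e∣ : ∀ c d e → ∣ d ∣ ℕ.* ∣ e ∣ ≤ ∣ c ∣ ℕ.+ ∣ c + d * e ∣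
∣d∣∣e∣≤∣c∣+∣c+d*e∣ c d e =
  subst₂ _≤_ (trans (cong ∣_∣ (ring c d e)) (ℤ.abs-* d e)) (cong (ℕ._+ ∣ c + d * e ∣) (ℤ.∣-i∣≡∣i∣ c))
    (ℤ.∣i+j∣≤∣i∣+∣j∣ (- c) (c + d * e))
  where
  ring : ∀ c d e → - c + (c + d * e) ≡ d * e
  ring = solve-∀

peel-bound : ∀ c a z e K n → 2 ℕ.* ∣ a ∣ < ∣ z ∣ →
             ∣ c + (z - a) * e ∣ ℕ.* ∣ z ∣ ≤ K ℕ.* ∣ z ∣ ℕ.^ suc n →
             ∣ e ∣ ℕ.* ∣ z ∣ ≤ 2 ℕ.* (K ℕ.+ ∣ c ∣) ℕ.* ∣ z ∣ ℕ.^ n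
peel-bound c a z e K n 2∣a∣<∣z∣ bound =
  ℕ.*-cancelʳ-≤ (∣ e ∣ ℕ.* t) (2 ℕ.* (K ℕ.+ ∣ c ∣) ℕ.* t ℕ.^ n) t (begin
    ∣ e ∣ ℕ.* t ℕ.* t
      ≤⟨ ℕ.*-monoˡ-≤ t e∣z∣≤ ⟩
    2 ℕ.* (∣ c ∣ ℕ.+ x) ℕ.* t
      ≡⟨ ring₁ ∣ c ∣ x t ⟩
    2 ℕ.* ∣ c ∣ ℕ.* t ℕ.+ 2 ℕ.* (x ℕ.* t)
      ≤⟨ ℕ.+-mono-≤ (ℕ.*-monoʳ-≤ (2 ℕ.* ∣ c ∣) t≤t^suc-n) (ℕ.*-monoʳ-≤ 2 bound) ⟩
    2 ℕ.* ∣ c ∣ ℕ.* (t ℕ.* t ℕ.^ n) ℕ.+ 2 ℕ.* (K ℕ.* (t ℕ.* t ℕ.^ n))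
      ≡⟨ ring₂ ∣ c ∣ K t (t ℕ.^ n) ⟩
    2 ℕ.* (K ℕ.+ ∣ c ∣) ℕ.* t ℕ.^ n ℕ.* t ∎)
  where
  open ℕ.≤-Reasoning
  ring₀ : ∀ e w → e ℕ.* (2 ℕ.* w) ≡ 2 ℕ.* (w ℕ.* e)
  ring₀ = ℕ-solve-∀
  ring₁ : ∀ c x t → 2 ℕ.* (c ℕ.+ x) ℕ.* t ≡ 2 ℕ.* c ℕ.* t ℕ.+ 2 ℕ.* (x ℕ.* t)
  ring₁ = ℕ-solve-∀
  ring₂ : ∀ c K t p → 2 ℕ.* c ℕ.* (t ℕ.* p) ℕ.+ 2 ℕ.* (K ℕ.* (t ℕ.* p)) ≡ 2 ℕ.* (K ℕ.+ c) ℕ.* p ℕ.* t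
  ring₂ = ℕ-solve-∀
  t x : ℕ
  t = ∣ z ∣
  x = ∣ c + (z - a) * e ∣
  instance
    t≢0 : ℕ.NonZero t
    t≢0 = ℕ.>-nonZero (ℕ.≤-<-trans ℕ.z≤n 2∣a∣<∣z∣)
  t≤t^suc-n : t ≤ t ℕ.* t ℕ.^ n
  t≤t^suc-n = ℕ.m≤m*n t (t ℕ.^ n) {{ℕ.m^n≢0 t n}}
  e∣z∣≤ : ∣ e ∣ ℕ.* t ≤ 2 ℕ.* (∣ c ∣ ℕ.+ x)
  e∣z∣≤ = begin
    ∣ e ∣ ℕ.* t                       ≤⟨ ℕ.*-monoʳ-≤ ∣ e ∣ (∣x∣≤2∣x-a∣ z a (ℕ.<⇒≤ 2∣a∣<∣z∣)) ⟩
    ∣ e ∣ ℕ.* (2 ℕ.* ∣ z - a ∣)       ≡⟨ ring₀ ∣ e ∣ ∣ z - a ∣ ⟩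
    2 ℕ.* (∣ z - a ∣ ℕ.* ∣ e ∣)       ≤⟨ ℕ.*-monoʳ-≤ 2 (∣d∣∣e∣≤∣c∣+∣c+d*e∣ c (z - a) e) ⟩
    2 ℕ.* (∣ c ∣ ℕ.+ x)               ∎

*-bounded⇒≡0 : ∀ m t K → K < t → m ℕ.* t ≤ K → m ≡ 0
*-bounded⇒≡0 zero    t K _   _    = refl
*-bounded⇒≡0 (suc m) t K K<t mt≤K = contradiction (ℕ.≤-trans (ℕ.m≤m+n t (m ℕ.* t)) mt≤K) (ℕ.<⇒≱ K<t)

nodeProduct∣-peel : ∀ P a as z m → nodeProduct (a ∷ as) z ∣ m - eval P z →
  ∃ λ m′ → m ≡ eval P a + (z - a) * m′ × nodeProduct as z ∣ m′ - eval (divLinear P a) z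
nodeProduct∣-peel P a as z m (divides k eq) = Qz + k * ω , m-split , divides k (ring₁ Qz k ω)
  where
  open ≡-Reasoning
  Qz ω : ℤ
  Qz = eval (divLinear P a) z
  ω  = nodeProduct as z
  ring₁ : ∀ q k r → (q + k * r) - q ≡ k * r
  ring₁ = solve-∀
  ring₂ : ∀ m p → m ≡ (m - p) + p
  ring₂ = solve-∀
  ring₃ : ∀ k d r c q → k * (d * r) + (c + d * q) ≡ c + d * (q + k * r)
  ring₃ = solve-∀
  m-split : m ≡ eval P a + (z - a) * (Qz + k * ω)
  m-split = begin
    m                                             ≡⟨ ring₂ m (eval P z) ⟩
    (m - eval P z) + eval P z                     ≡⟨ cong₂ _+_ eq (eval-divLinear P a z) ⟩
    k * ((z - a) * ω) + (eval P a + (z - a) * Qz) ≡⟨ ring₃ k (z - a) ω (eval P a) Qz ⟩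
    eval P a + (z - a) * (Qz + k * ω)             ∎

-- |m| · |z| ≤ K |z|^n stands for |m| ≤ K |z|^(n-1) without truncated subtraction.  Each node
-- a is peeled off via m = P(a) + (z - a) m′, and |z - a| ≥ |z| / 2 keeps the bound on m′.
bounded-congruent⇒≡eval : ∀ as P → length P ≤ length as → ∀ K → ∃ λ N → ∀ z m → N ≤ ∣ z ∣ →
  nodeProduct as z ∣ m - eval P z → ∣ m ∣ ℕ.* ∣ z ∣ ≤ K ℕ.* ∣ z ∣ ℕ.^ length as → m ≡ eval P z
bounded-congruent⇒≡eval []       [] _ K = suc K , λ z m K<∣z∣ _ bound →
  ℤ.∣i∣≡0⇒i≡0 (*-bounded⇒≡0 ∣ m ∣ ∣ z ∣ K K<∣z∣ (subst (∣ m ∣ ℕ.* ∣ z ∣ ≤_) (ℕ.*-identityʳ K) bound))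
bounded-congruent⇒≡eval (a ∷ as) P ∣P∣≤ K
  with bounded-congruent⇒≡eval as (divLinear P a) (length-divLinear P a ∣P∣≤) (2 ℕ.* (K ℕ.+ ∣ eval P a ∣))
... | N′ , IH = N′ ℕ.⊔ suc (2 ℕ.* ∣ a ∣) , large⇒≡eval
  where
  large⇒≡eval : ∀ z m → N′ ℕ.⊔ suc (2 ℕ.* ∣ a ∣) ≤ ∣ z ∣ → nodeProduct (a ∷ as) z ∣ m - eval P z →
                ∣ m ∣ ℕ.* ∣ z ∣ ≤ K ℕ.* ∣ z ∣ ℕ.^ length (a ∷ as) → m ≡ eval P z
  large⇒≡eval z m N≤∣z∣ congruent bound with nodeProduct∣-peel P a as z m congruent
  ... | m′ , refl , congruent′ = begin
    eval P a + (z - a) * m′                     ≡⟨ cong (λ v → eval P a + (z - a) * v) m′≡Qz ⟩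
    eval P a + (z - a) * eval (divLinear P a) z ≡⟨ eval-divLinear P a z ⟨
    eval P z                                    ∎
    where
    open ≡-Reasoning
    m′≡Qz : m′ ≡ eval (divLinear P a) z
    m′≡Qz = IH z m′ (ℕ.≤-trans (ℕ.m≤m⊔n N′ _) N≤∣z∣) congruent′
      (peel-bound (eval P a) a z m′ K (length as) (ℕ.≤-trans (ℕ.m≤n⊔m N′ _) N≤∣z∣) bound)

≤*^⇒*≤*^suc : ∀ K t n {a} → a ≤ K ℕ.* t ℕ.^ n → a ℕ.* t ≤ K ℕ.* t ℕ.^ suc n
≤*^⇒*≤*^suc K t n {a} a≤ = subst (a ℕ.* t ≤_) (ring K t (t ℕ.^ n)) (ℕ.*-monoˡ-≤ t a≤)
  where
  ring : ∀ K t p → K ℕ.* p ℕ.* t ≡ K ℕ.* (t ℕ.* p)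
  ring = ℕ-solve-∀

far-divisor⇒≡0 : ∀ y z e → (y - z) ∣ e → ∣ y ∣ ℕ.+ ∣ e ∣ < ∣ z ∣ → e ≡ + 0
far-divisor⇒≡0 y z e y-z∣e far with e ℤ.≟ + 0
... | yes e≡0 = e≡0
... | no  e≢0 = contradiction far (ℕ.≤⇒≯ (begin
  ∣ z ∣               ≡⟨ cong ∣_∣ (ring y z) ⟩
  ∣ y - (y - z) ∣     ≤⟨ ℤ.∣i-j∣≤∣i∣+∣j∣ y (y - z) ⟩
  ∣ y ∣ ℕ.+ ∣ y - z ∣ ≤⟨ ℕ.+-monoʳ-≤ ∣ y ∣ (∣⇒≤ (∣⇒∣ᵤ y-z∣e)) ⟩
  ∣ y ∣ ℕ.+ ∣ e ∣     ∎))
  where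
  open ℕ.≤-Reasoning
  instance
    ∣e∣≢0 : ℕ.NonZero ∣ e ∣
    ∣e∣≢0 = ℕ.≢-nonZero (e≢0 ∘ ℤ.∣i∣≡0⇒i≡0)
  ring : ∀ y z → z ≡ y - (y - z)
  ring = solve-∀

toℚ-+ : ∀ n → toℚ (+ n) ≡ mkℚ (+ n) 0 (Coprime.sym (1-coprimeTo n))
toℚ-+ n = ℚ.normalize-coprime (Coprime.sym (1-coprimeTo n))

i≤+∣i∣ : ∀ i → i ℤ.≤ + ∣ i ∣
i≤+∣i∣ (+ n)    = ℤ.≤-refl
i≤+∣i∣ ℤ.-[1+ n ] = ℤ.-≤+

toℚ-≤⇒ : ∀ C n m → toℚ (+ n) ℚ.≤ C ℚ.* toℚ (+ m) → n ≤ ∣ ℚ.↥ C ∣ ℕ.* m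
toℚ-≤⇒ C@(mkℚ c e _) n m n≤Cm rewrite toℚ-+ n | toℚ-+ m
  with ℚᵘ.≤-respʳ-≃ (ℚ.toℚᵘ-homo-* C (mkℚ (+ m) 0 (Coprime.sym (1-coprimeTo m)))) (ℚ.toℚᵘ-mono-≤ n≤Cm)
... | ℚᵘ.*≤* n*d≤c*m*1 = ℤ.drop‿+≤+ (begin
  + n                     ≤⟨ ℤ.+≤+ (ℕ.m≤m*n n (suc e ℕ.* 1)) ⟩
  + (n ℕ.* suc (e ℕ.* 1)) ≡⟨ ℤ.pos-* n (suc e ℕ.* 1) ⟩
  + n * + suc (e ℕ.* 1)   ≤⟨ n*d≤c*m*1 ⟩
  c * + m * + 1           ≡⟨ ℤ.*-identityʳ (c * + m) ⟩
  c * + m                 ≤⟨ i≤+∣i∣ (c * + m) ⟩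
  + ∣ c * + m ∣           ≡⟨ cong +_ (ℤ.abs-* c (+ m)) ⟩
  + (∣ c ∣ ℕ.* m)         ∎)
  where open ℤ.≤-Reasoning

ball : ℕ → List ℤ
ball zero    = + 0 ∷ []
ball (suc M) = + suc M ∷ ℤ.-[1+ M ] ∷ ball M

∈-ball : ∀ M x → ∣ x ∣ ≤ M → x ∈ ball M
∈-ball zero    (+ zero)     _ = here refl
∈-ball (suc M) (+ n)        n≤1+M with ℕ.m≤n⇒m<n∨m≡n n≤1+M
... | inj₁ n≤M = there (there (∈-ball M (+ n) (ℕ.≤-pred n≤M)))
... | inj₂ refl = here refl
∈-ball (suc M) ℤ.-[1+ n ]  n<1+M with ℕ.m≤n⇒m<n∨m≡n (ℕ.≤-pred n<1+M)
... | inj₁ n<M = there (there (∈-ball M ℤ.-[1+ n ] n<M))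
... | inj₂ refl = there (here refl)

module _ {P : ℤ → Set} (infinite : InfinitelyMany P) where

  InfinitelyMany-far : ∀ xs M → ∃ λ x → P x × x ∉ xs × M < ∣ x ∣
  InfinitelyMany-far xs M with infinite (xs ++ ball M)
  ... | x , Px , x∉ = x , Px , x∉ ∘ ∈-++⁺ˡ , ℕ.≰⇒> (x∉ ∘ ∈-++⁺ʳ xs ∘ ∈-ball M x)

  distinct-points : ∀ n → ∃ λ (xs : List (Σ ℤ P)) → AllPairs _≢_ (map proj₁ xs) × length xs ≡ n
  distinct-points zero = [] , [] , refl
  distinct-points (suc n) with distinct-points n
  ... | xs , distinct , refl with infinite (map proj₁ xs)
  ... | x , Px , x∉xs = (x , Px) ∷ xs , ¬Any⇒All¬ (map proj₁ xs) x∉xs ∷ distinct , refl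

module _ {U : Subset} (f : FunOn U) (lip : IsLIP U f) where

  AgreesOn : Poly → List (Σ ℤ U) → Set
  AgreesOn p = All (λ xu → eval p (proj₁ xu) ≡ f (proj₁ xu) (proj₂ xu))

  lip-interpolant : ∀ A → ∃ λ p → length p ≡ length (map proj₁ A) × AgreesOn p A
  lip-interpolant A with lip A
  ... | q , q-on-A = interpolate (map proj₁ A) q , length-interpolate (map proj₁ A) q ,
    All.zipWith (λ (p≡q , q≡f) → trans p≡q q≡f) (map⁻ (interpolate-agrees (map proj₁ A) q) , q-on-A)

  agreesOn⇒nodeProduct∣ : ∀ p A → AllPairs _≢_ (map proj₁ A) → AgreesOn p A →
                          ∀ y (u : U y) → nodeProduct (map proj₁ A) y ∣ f y u - eval p y
  agreesOn⇒nodeProduct∣ p A distinct p-on-A y u with lip ((y , u) ∷ A)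
  ... | q , qy≡fy ∷ q-on-A = subst (λ v → nodeProduct (map proj₁ A) y ∣ v - eval p y) qy≡fy
    (agree⇒nodeProduct∣ q p distinct (map⁺ (All.zipWith (λ (q≡f , p≡f) → trans q≡f (sym p≡f))
                                                           (q-on-A , p-on-A))) y)

  agrees-often⇒agrees : ∀ p → InfinitelyMany (λ x → Σ (U x) λ u → f x u ≡ eval p x) →
                        ∀ y (u : U y) → f y u ≡ eval p y
  agrees-often⇒agrees p often y u with InfinitelyMany-far often [] (∣ y ∣ ℕ.+ ∣ f y u - eval p y ∣)
  ... | z , (v , fz≡pz) , _ , far =
    ℤ.i-j≡0⇒i≡j (f y u) (eval p y) (far-divisor⇒≡0 y z (f y u - eval p y) y-z∣fy-py far)
    where
    y-z∣fy-py : (y - z) ∣ f y u - eval p y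
    y-z∣fy-py = subst (_∣ f y u - eval p y) (ℤ.*-identityʳ (y - z))
                  (agreesOn⇒nodeProduct∣ p ((z , v) ∷ []) ([] ∷ []) (sym fz≡pz ∷ []) y u)

theorem3 : (U : Subset) → Infinite U → (C : ℚ) → (d : ℕ) →
    (f : FunOn U) → IsLIP U f →
    InfinitelyMany (λ x → Σ (U x) λ u →
      toℚ (+ ∣ f x u ∣) ℚ.≤ C ℚ.* toℚ (+ (∣ x ∣ Data.Nat.^ d))) →
    ∃ λ (p : Poly) → (x : ℤ) (u : U x) → f x u ≡ eval p x
theorem3 U infinite C d f lip bounded with distinct-points infinite (suc d)
... | A , distinct , |A|≡1+d with lip-interpolant f lip A
... | P , |P|≡|A| , P-on-A with bounded-congruent⇒≡eval (map proj₁ A) P (ℕ.≤-reflexive |P|≡|A|) ∣ ℚ.↥ C ∣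
... | N , growth = P , agrees-often⇒agrees f lip P agrees-often
  where
  |nodes|≡1+d : length (map proj₁ A) ≡ suc d
  |nodes|≡1+d = trans (length-map proj₁ A) |A|≡1+d
  agrees-often : InfinitelyMany (λ x → Σ (U x) λ u → f x u ≡ eval P x)
  agrees-often xs with InfinitelyMany-far bounded xs N
  ... | z , (u , fz≤Cz^d) , z∉xs , N<∣z∣ = z , (u , fz≡Pz) , z∉xs
    where
    fz≡Pz : f z u ≡ eval P z
    fz≡Pz = growth z (f z u) (ℕ.<⇒≤ N<∣z∣) (agreesOn⇒nodeProduct∣ f lip P A distinct P-on-A z u)
      (subst (λ n → ∣ f z u ∣ ℕ.* ∣ z ∣ ≤ ∣ ℚ.↥ C ∣ ℕ.* ∣ z ∣ ℕ.^ n) (sym |nodes|≡1+d)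
        (≤*^⇒*≤*^suc ∣ ℚ.↥ C ∣ ∣ z ∣ d (toℚ-≤⇒ C ∣ f z u ∣ (∣ z ∣ ℕ.^ d) fz≤Cz^d)))
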